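{- Let $P$ be an acyclic CR-Prolog program having an answer set $X$ with a corresponding abductive support $R$ (i.e. $X$ is an answer set of $P^{reg}\cup\alpha(R)$). Let $r\in R$ be a cr-rule with $\mathrm{head}(r)=\{l\}$. Then $\alpha(r)$ is the only rule in $P^{reg}\cup\alpha(R)$ which supports $l$ with respect to $X$.
   Context: A literal is an atom $a$ or its classical negation $\neg a$; a context is a consistent set of literals (all contexts considered are consistent). A regular rule $r$ has the form $l_1 \vee \dots \vee l_k \leftarrow l_{k+1},\dots,l_m, \mathrm{not}\ l_{m+1},\dots,\mathrm{not}\ l_n$ with $1\le k\le m\le n$; $\mathrm{head}(r)=\{l_1,\dots,l_k\}$, $\mathrm{pos}(r)=\{l_{k+1},\dots,l_m\}$. $r$ fires w.r.t. a context $X$ if $l_{k+1},\dots,l_m\in X$ and $l_{m+1},\dots,l_n\notin X$; $X$ satisfies $r$ if whenever $r$ fires, $\mathrm{head}(r)\cap X\ne\emptyset$. A literal $l$ is supported by a regular rule $r$ w.r.t. $X$ if $r$ fires w.r.t. $X$ and $\mathrm{head}(r)\cap X=\{l\}$. An A-Prolog program is a finite set of regular rules. For a program without default negation ($m=n$ in all rules), $X$ is an answer set if $X$ satisfies it and no proper subset does; in general, the reduct $P^X$ removes every rule containing $\mathrm{not}\ l$ with $l\in X$ and deletes the remaining $\mathrm{not}$-literals, and $X$ is an answer set of $P$ if it is an answer set of $P^X$; $P$ is consistent if it has an answer set. A cr-rule has the form $l_0 \stackrel{+}{\leftarrow} l_1,\dots,l_m,\mathrm{not}\ l_{m+1},\dots,\mathrm{not}\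 l_n$, with $\mathrm{head}=\{l_0\}$, $\mathrm{pos}=\{l_1,\dots,l_m\}$. A CR-Prolog program $P$ is a finite set of regular rules and cr-rules, $P^{reg}$ its regular rules, $P^{cr}$ its cr-rules. $\alpha(r)$ is the regular rule obtained from a cr-rule $r$ by replacing $\stackrel{+}{\leftarrow}$ by $\leftarrow$; $\alpha(R)=\{\alpha(r):r\in R\}$. $R\subseteq P^{cr}$ is an abductive support of $P$ if $P^{reg}\cup\alpha(R)$ is consistent and no $R'\subseteq P^{cr}$ with $|R'|<|R|$ makes $P^{reg}\cup\alpha(R')$ consistent. $X$ is an answer set of $P$ if it is an answer set of $P^{reg}\cup\alpha(R)$ for some abductive support $R$ (a corresponding abductive support). The dependency graph of $P$ has the literals of $P$ as vertices and an edge from $l_2$ to $l_1$ iff some rule $r\in P$ has $l_1\in\mathrm{head}(r)$ and $l_2\in\mathrm{pos}(r)$; $P$ is acyclic if this graph has no directed cycle. -}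

module Defs where

open import Data.Nat as ℕ using (ℕ; _<_)
import Data.Nat.Properties as ℕP
open import Data.Fin using (Fin)
open import Data.Fin.Subset using (Subset; ∣_∣) renaming (_∈_ to _∈ₛ_)
open import Data.Fin.Subset.Properties using () renaming (_∈?_ to _∈ₛ?_)
open import Data.List using (List; []; _∷_; _++_; map; filter; length; lookup; allFin)
open import Data.List.Relation.Unary.All using (All; all?)
open import Data.List.Relation.Unary.Any using (Any)
open import Data.Product using (Σ; ∃; _×_; _,_)
open import Data.Empty using (⊥)
open import Data.Sum using (_⊎_)
import Data.List.Membership.Propositional as ListMem
open import Relation.Nullary using (¬_; Dec; yes; no; ¬?)
open import Relation.Binary.Definitions using (DecidableEquality)
open import Relation.Binary.PropositionalEquality using (_≡_; refl; cong)
open import Relation.Binary.Construct.Closure.Transitive using (TransClosure)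

-- Atoms are natural numbers; literals are atoms or their classical negations.

data Lit : Set where
  pos : ℕ → Lit
  neg : ℕ → Lit

_≟L_ : DecidableEquality Lit
pos a ≟L pos b with a ℕP.≟ b
... | yes refl = yes refl
... | no a≢b = no λ { refl → a≢b refl }
pos a ≟L neg b = no λ ()
neg a ≟L pos b = no λ ()
neg a ≟L neg b with a ℕP.≟ b
... | yes refl = yes refl
... | no a≢b = no λ { refl → a≢b refl }

open import Data.List.Membership.DecPropositional _≟L_ public
  using (_∈_; _∉_; _∈?_)

-- A context is a (finite) set of literals, represented by a list
-- (only membership matters).
Context : Set
Context = List Lit

Consistent : Context → Set
Consistent X = ∀ a → pos a ∈ X → neg a ∈ X → ⊥

_⊆_ : Context → Context → Set
Y ⊆ X = ∀ {l} → l ∈ Y → l ∈ X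

_⊂_ : Context → Context → Set
Y ⊂ X = Y ⊆ X × ∃ λ l → l ∈ X × l ∉ Y

-- Regular rules  l₁ ∨ … ∨ lₖ ← l_{k+1},…,l_m, not l_{m+1},…,not l_n  (k ≥ 1)
-- head = hd ∷ hds (nonempty), pos = body⁺, the default-negated literals = body⁻.

record Rule : Set where
  constructor mkRule
  field
    hd    : Lit
    hds   : List Lit
    body⁺ : List Lit
    body⁻ : List Lit

  head : List Lit
  head = hd ∷ hds

open Rule public

Fires : Rule → Context → Set
Fires r X = All (_∈ X) (body⁺ r) × All (_∉ X) (body⁻ r)

Satisfies : Context → Rule → Set
Satisfies X r = Fires r X → Any (_∈ X) (head r)

Supports : Rule → Lit → Context → Set
Supports r l X =
  Fires r X × l ∈ head r × l ∈ X × (∀ l′ → l′ ∈ head r → l′ ∈ X → l′ ≡ l)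

Program : Set
Program = List Rule

SatisfiesProg : Context → Program → Set
SatisfiesProg X P = All (Satisfies X) P

-- answer set of a program without default negation
-- (all contexts considered are consistent)
AnswerSet⁺ : Program → Context → Set
AnswerSet⁺ P X =
  Consistent X × SatisfiesProg X P ×
  (∀ Y → Consistent Y → Y ⊂ X → ¬ SatisfiesProg Y P)

NotBlocked : Context → Rule → Set
NotBlocked X r = All (_∉ X) (body⁻ r)

notBlocked? : ∀ X r → Dec (NotBlocked X r)
notBlocked? X r = all? (λ l → ¬? (l ∈? X)) (body⁻ r)

stripNot : Rule → Rule
stripNot r = mkRule (hd r) (hds r) (body⁺ r) []

reduct : Program → Context → Program
reduct P X = map stripNot (filter (notBlocked? X) P)

AnswerSet : Program → Context → Set
AnswerSet P X = AnswerSet⁺ (reduct P X) X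

ConsistentProg : Program → Set
ConsistentProg P = ∃ λ X → AnswerSet P X

record CRRule : Set where
  constructor mkCR
  field
    crHead : Lit
    cr⁺    : List Lit
    cr⁻    : List Lit

open CRRule public

α : CRRule → Rule
α r = mkRule (crHead r) [] (cr⁺ r) (cr⁻ r)

record CRProgram : Set where
  constructor mkCRProgram
  field
    reg : List Rule
    crs : List CRRule

open CRProgram public

-- subsets of P^cr are subsets of the index set of the cr-rules
CRSubset : CRProgram → Set
CRSubset P = Subset (length (crs P))

crRule : (P : CRProgram) → Fin (length (crs P)) → CRRule
crRule P i = lookup (crs P) i

αSet : (P : CRProgram) → CRSubset P → Program
αSet P R = map (λ i → α (crRule P i)) (filter (λ i → i ∈ₛ? R) (allFin (length (crs P))))

withCR : (P : CRProgram) → CRSubset P → Program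
withCR P R = reg P ++ αSet P R

AbductiveSupport : (P : CRProgram) → CRSubset P → Set
AbductiveSupport P R =
  ConsistentProg (withCR P R) ×
  (∀ (R′ : CRSubset P) → ∣ R′ ∣ < ∣ R ∣ → ¬ ConsistentProg (withCR P R′))

Edge : CRProgram → Lit → Lit → Set
Edge P l₂ l₁ =
  (∃ λ r → r ListMem.∈ reg P × l₁ ∈ head r × l₂ ∈ body⁺ r) ⊎
  (∃ λ r → r ListMem.∈ crs P × l₁ ≡ crHead r × l₂ ∈ cr⁺ r)

Acyclic : CRProgram → Set
Acyclic P = ∀ l → ¬ TransClosure (Edge P) l l

module Submission where

-- Write Q = P^reg ∪ α(R) and rᵢ ∈ R with head l.
-- Removing rᵢ from R yields the smaller candidate R − {i}; by minimality of
-- the abductive support R, X is NOT an answer set of Q' = P^reg ∪ α(R − {i}).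
-- The whole argument is that X would be one as soon as every literal of X
-- had a supporting rule in Q other than α(rᵢ):
--   (1) every literal of an answer set is supported by some rule
--       (otherwise deleting it gives a smaller model of the reduct);
--   (2) conversely, if Q' ⊆ Q only produces edges of an acyclic graph and
--       supports every literal of an answer set X of Q, then X is an answer
--       set of Q' (a smaller model Y of Q'^X would give an infinite chain of
--       predecessors in X ∖ Y, hence a cycle by the pigeonhole principle).
-- So α(rᵢ) is indispensable as a supporter.  If α(rᵢ) did not fire, it would
-- support nothing; hence it fires and, having the single head l, supports l.
-- If another rule r′ supported l, then r′ could replace α(rᵢ) everywhere.

open import Defs
open import Data.Fin using (Fin)
open import Data.List using (length)
open import Data.Fin.Subset using () renaming (_∈_ to _∈ₛ_)
open import Data.Product using (_×_)
open import Relation.Binary.PropositionalEquality using (_≡_)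
open import Data.List.Membership.Propositional using () renaming (_∈_ to _∈ₚ_)

open import Data.Nat as ℕ using (ℕ; zero; suc)
import Data.Nat.Properties as ℕP
open import Data.Fin using (toℕ)
import Data.Fin.Properties as FP
import Data.Fin.Subset as S
import Data.Fin.Subset.Properties as SP
open import Data.List using (List; filter; allFin; lookup)
import Data.List.Properties as LP
import Data.List.Relation.Unary.All as All
open import Data.List.Relation.Unary.All using (All; []; all?)
import Data.List.Relation.Unary.Any as Any
open import Data.List.Relation.Unary.Any using (here; any?)
import Data.List.Relation.Unary.Any.Properties as AnyP
open import Data.List.Relation.Unary.All.Properties.Core using (¬All⇒Any¬)
open import Data.List.Membership.Propositional using (find)
open import Data.List.Membership.Propositional.Properties
open import Data.Product using (Σ; ∃; _,_; proj₁; proj₂)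
open import Data.Sum using (inj₁; inj₂)
open import Data.Empty using (⊥-elim)
open import Relation.Nullary using (¬_; Dec; yes; no; ¬?; _×-dec_; _→-dec_)
open import Relation.Binary.PropositionalEquality using (_≢_; refl; sym; trans; cong; subst)
open import Relation.Binary.Construct.Closure.Transitive using (TransClosure; [_]; _∷_)

_≟R_ : (r s : Rule) → Dec (r ≡ s)
mkRule a b c d ≟R mkRule a′ b′ c′ d′
  with a ≟L a′ | LP.≡-dec _≟L_ b b′ | LP.≡-dec _≟L_ c c′ | LP.≡-dec _≟L_ d d′
... | yes refl | yes refl | yes refl | yes refl = yes refl
... | no a≢   | _        | _        | _        = no λ { refl → a≢ refl }
... | yes _    | no b≢    | _        | _        = no λ { refl → b≢ refl }
... | yes _    | yes _    | no c≢    | _        = no λ { refl → c≢ refl }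
... | yes _    | yes _    | yes _    | no d≢    = no λ { refl → d≢ refl }

fires? : ∀ r X → Dec (Fires r X)
fires? r X = all? (_∈? X) (body⁺ r) ×-dec all? (λ l → ¬? (l ∈? X)) (body⁻ r)

supports? : ∀ r l X → Dec (Supports r l X)
supports? r l X with fires? r X | l ∈? head r | l ∈? X
                   | all? (λ l′ → (l′ ∈? X) →-dec (l′ ≟L l)) (head r)
... | yes f | yes h | yes x | yes u = yes (f , h , x , λ l′ p q → All.lookup u p q)
... | no ¬f | _     | _     | _     = no λ s → ¬f (proj₁ s)
... | yes _ | no ¬h | _     | _     = no λ s → ¬h (proj₁ (proj₂ s))
... | yes _ | yes _ | no ¬x | _     = no λ s → ¬x (proj₁ (proj₂ (proj₂ s)))
... | yes _ | yes _ | yes _ | no ¬u =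
  no λ s → ¬u (All.tabulate λ {l′} p q → proj₂ (proj₂ (proj₂ s)) l′ p q)

∈-reduct⁻ : ∀ {Q X t} → t ∈ₚ reduct Q X →
            ∃ λ s → s ∈ₚ Q × NotBlocked X s × t ≡ stripNot s
∈-reduct⁻ {Q} {X} t∈ with ∈-map⁻ stripNot t∈
... | s , s∈ , t≡ = s , proj₁ kept , proj₂ kept , t≡
  where kept = ∈-filter⁻ (notBlocked? X) {xs = Q} s∈

∈-reduct⁺ : ∀ {Q X s} → s ∈ₚ Q → NotBlocked X s → stripNot s ∈ₚ reduct Q X
∈-reduct⁺ {X = X} s∈ nb = ∈-map⁺ stripNot (∈-filter⁺ (notBlocked? X) s∈ nb)

reduct-mono : ∀ {Q Q′ X t} → (∀ {s} → s ∈ₚ Q′ → s ∈ₚ Q) →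
              t ∈ₚ reduct Q′ X → t ∈ₚ reduct Q X
reduct-mono {Q} {Q′} {X} Q′⊆Q t∈ with ∈-reduct⁻ {Q′} {X} t∈
... | s , s∈ , nb , refl = ∈-reduct⁺ {Q} {X} (Q′⊆Q s∈) nb

answerSet⇒satisfies : ∀ {Q X} → AnswerSet Q X → SatisfiesProg X Q
answerSet⇒satisfies (_ , satX , _) = All.tabulate λ {s} s∈ fires →
  All.lookup satX (∈-reduct⁺ s∈ (proj₂ fires)) (proj₁ fires , [])

Supported : Program → Context → Set
Supported Q X = ∀ l → l ∈ X → ∃ λ s → s ∈ₚ Q × Supports s l X

_∖_ : Context → Lit → Context
X ∖ l = filter (λ x → ¬? (x ≟L l)) X

∖-⊆ : ∀ {X l} → (X ∖ l) ⊆ X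
∖-⊆ {X} {l} x∈ = proj₁ (∈-filter⁻ (λ x → ¬? (x ≟L l)) {xs = X} x∈)

∖-∉ : ∀ {X l} → l ∉ (X ∖ l)
∖-∉ {X} {l} l∈ = proj₂ (∈-filter⁻ (λ x → ¬? (x ≟L l)) {xs = X} l∈) refl

-- A literal l of an answer set X that no rule supports can be deleted:
-- every rule of Q^X firing on X ∖ l has a head literal in X other than l.
unsupported-deletable : ∀ {Q X l} → AnswerSet Q X →
                        ¬ (∃ λ s → s ∈ₚ Q × Supports s l X) →
                        SatisfiesProg (X ∖ l) (reduct Q X)
unsupported-deletable {Q} {X} {l} A unsupported = All.tabulate satisfied
  where
    satisfiedStripped : ∀ {s} → s ∈ₚ Q → NotBlocked X s → Satisfies (X ∖ l) (stripNot s)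
    satisfiedStripped {s} s∈ nb (body⊆ , [])
      with any? (λ h → (h ∈? X) ×-dec ¬? (h ≟L l)) (head s)
    ... | yes other = Any.map (λ (h∈X , h≢l) → ∈-filter⁺ (λ x → ¬? (x ≟L l)) h∈X h≢l) other
    ... | no noOther = ⊥-elim (unsupported (s , s∈ , firesX , l∈head , l∈X , only-l))
      where
        firesX : Fires s X
        firesX = All.map ∖-⊆ body⊆ , nb
        only-l : ∀ l′ → l′ ∈ head s → l′ ∈ X → l′ ≡ l
        only-l l′ l′∈ l′∈X with l′ ≟L l
        ... | yes l′≡l = l′≡l
        ... | no l′≢l = ⊥-elim (noOther (Any.map (λ { refl → l′∈X , l′≢l }) l′∈))
        headInX : ∃ λ h → h ∈ head s × h ∈ X
        headInX = find (All.lookup (answerSet⇒satisfies A) s∈ firesX)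
        l∈head : l ∈ head s
        l∈head = let (h , h∈ , h∈X) = headInX in subst (_∈ head s) (only-l h h∈ h∈X) h∈
        l∈X : l ∈ X
        l∈X = let (h , h∈ , h∈X) = headInX in subst (_∈ X) (only-l h h∈ h∈X) h∈X

    satisfied : ∀ {t} → t ∈ₚ reduct Q X → Satisfies (X ∖ l) t
    satisfied t∈ with ∈-reduct⁻ {Q} {X} t∈
    ... | s , s∈ , nb , refl = satisfiedStripped s∈ nb

answerSet⇒supported : ∀ {Q X} → AnswerSet Q X → Supported Q X
answerSet⇒supported {Q} {X} A@(consistent , _ , minimal) l l∈X
  with any? (λ s → supports? s l X) Q
... | yes supported = find supported
... | no unsupported =
  ⊥-elim (minimal (X ∖ l) (λ a p q → consistent a (∖-⊆ p) (∖-⊆ q))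
                  (∖-⊆ , l , l∈X , ∖-∉ {X})
                  (unsupported-deletable A λ (s , s∈ , sup) →
                     unsupported (Any.map (λ { refl → sup }) s∈)))

-- If every element of a nonempty subset N of a finite list has an
-- E-predecessor in N, then E has a cycle: follow predecessors for
-- length xs + 1 steps and apply the pigeonhole principle.
descent⇒cycle : ∀ {A : Set} (E : A → A → Set) (N : A → Set) (xs : List A) →
                (∀ {a} → N a → a ∈ₚ xs) →
                (∀ {a} → N a → ∃ λ a′ → N a′ × E a′ a) →
                ∀ {a₀} → N a₀ → ∃ λ a → TransClosure E a a
descent⇒cycle {A} E N xs N⊆xs predecessor {a₀} Na₀ = _ , cycle
  where
    chain : ℕ → Σ A N
    chain zero = a₀ , Na₀
    chain (suc k) = let (a′ , Na′ , _) = predecessor (proj₂ (chain k)) in a′ , Na′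

    point : ℕ → A
    point k = proj₁ (chain k)

    link : ∀ k → E (point (suc k)) (point k)
    link k = proj₂ (proj₂ (predecessor (proj₂ (chain k))))

    path : ∀ i j → i ℕ.< j → TransClosure E (point j) (point i)
    path i (suc j) i<1+j with ℕP.m<1+n⇒m<n∨m≡n i<1+j
    ... | inj₁ i<j  = link j ∷ path i j i<j
    ... | inj₂ refl = [ link j ]

    position : Fin (suc (length xs)) → Fin (length xs)
    position k = Any.index (N⊆xs (proj₂ (chain (toℕ k))))

    samePosition : ∀ a b → position a ≡ position b → point (toℕ a) ≡ point (toℕ b)
    samePosition a b eq = trans (AnyP.lookup-index (N⊆xs (proj₂ (chain (toℕ a)))))
      (trans (cong (lookup xs) eq) (sym (AnyP.lookup-index (N⊆xs (proj₂ (chain (toℕ b)))))))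

    collision : ∃ λ i → ∃ λ j → toℕ i ℕ.< toℕ j × position i ≡ position j
    collision = FP.pigeonhole (ℕP.n<1+n (length xs)) position

    i j : Fin (suc (length xs))
    i = proj₁ collision
    j = proj₁ (proj₂ collision)

    cycle : TransClosure E (point (toℕ j)) (point (toℕ j))
    cycle = subst (TransClosure E (point (toℕ j)))
                  (samePosition i j (proj₂ (proj₂ (proj₂ collision))))
                  (path (toℕ i) (toℕ j) (proj₁ (proj₂ (proj₂ collision))))

supported-escapes : ∀ {Q X Y s l} → Y ⊆ X → SatisfiesProg Y (reduct Q X) →
                    s ∈ₚ Q → Supports s l X → l ∉ Y →
                    ∃ λ l′ → l′ ∈ body⁺ s × l′ ∈ X × l′ ∉ Y
supported-escapes {Y = Y} {s} Y⊆X satY s∈ (fires , _ , _ , only-l) l∉Y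
  with all? (_∈? Y) (body⁺ s)
... | yes body⊆Y with find (All.lookup satY (∈-reduct⁺ s∈ (proj₂ fires)) (body⊆Y , []))
...   | h , h∈ , h∈Y = ⊥-elim (l∉Y (subst (_∈ Y) (only-l h h∈ (Y⊆X h∈Y)) h∈Y))
supported-escapes {Y = Y} {s} Y⊆X satY s∈ (fires , _ , _ , only-l) l∉Y
    | no body⊈Y with find (¬All⇒Any¬ (_∈? Y) (body⁺ s) body⊈Y)
...   | l′ , l′∈ , l′∉Y = l′ , l′∈ , All.lookup (proj₁ fires) l′∈ , l′∉Y

-- An answer set X
-- of Q that is supported by Q′ is an answer set of Q′: a proper submodel Y
-- of Q′^X would give every literal of X ∖ Y an E-predecessor in X ∖ Y.
supported⇒answerSet : (E : Lit → Lit → Set) → (∀ l → ¬ TransClosure E l l) →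
                      ∀ {Q Q′ X} → AnswerSet Q X → (∀ {s} → s ∈ₚ Q′ → s ∈ₚ Q) →
                      (∀ {s l l′} → s ∈ₚ Q′ → l ∈ head s → l′ ∈ body⁺ s → E l′ l) →
                      Supported Q′ X → AnswerSet Q′ X
supported⇒answerSet E acyclic {Q′ = Q′} {X} (consistent , satX , _) Q′⊆Q edge supported =
  consistent , All.tabulate (λ t∈ → All.lookup satX (reduct-mono Q′⊆Q t∈)) , minimal
  where
    minimal : ∀ Y → Consistent Y → Y ⊂ X → ¬ SatisfiesProg Y (reduct Q′ X)
    minimal Y _ (Y⊆X , l₀ , l₀∈X , l₀∉Y) satY =
      let (l , cyc) = descent⇒cycle E (λ l → l ∈ X × l ∉ Y) X proj₁ predecessor (l₀∈X , l₀∉Y)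
      in acyclic l cyc
      where
        predecessor : ∀ {l} → l ∈ X × l ∉ Y → ∃ λ l′ → (l′ ∈ X × l′ ∉ Y) × E l′ l
        predecessor {l} (l∈X , l∉Y) with supported l l∈X
        ... | s , s∈ , sup with supported-escapes Y⊆X satY s∈ sup l∉Y
        ...   | l′ , l′∈ , l′∈X , l′∉Y = l′ , (l′∈X , l′∉Y) , edge s∈ (proj₁ (proj₂ sup)) l′∈

∈-αSet⁻ : ∀ {P R s} → s ∈ₚ αSet P R → ∃ λ j → j ∈ₛ R × s ≡ α (crRule P j)
∈-αSet⁻ {P} {R} s∈ with ∈-map⁻ (λ j → α (crRule P j)) s∈
... | j , j∈ , s≡ = j , proj₂ (∈-filter⁻ (SP._∈? R) {xs = allFin (length (crs P))} j∈) , s≡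

∈-αSet⁺ : ∀ {P R j} → j ∈ₛ R → α (crRule P j) ∈ₚ αSet P R
∈-αSet⁺ {P} {R} {j} j∈R =
  ∈-map⁺ (λ j → α (crRule P j)) (∈-filter⁺ (SP._∈? R) (∈-allFin j) j∈R)

withCR-edge : ∀ P R {s l l′} → s ∈ₚ withCR P R → l ∈ head s → l′ ∈ body⁺ s → Edge P l′ l
withCR-edge P R {s} s∈ l∈ l′∈ with ∈-++⁻ (reg P) s∈
... | inj₁ s∈reg = inj₁ (s , s∈reg , l∈ , l′∈)
... | inj₂ s∈α with ∈-αSet⁻ {P} {R} s∈α
...   | j , _ , refl = inj₂ (crRule P j , ∈-lookup j , AnyP.singleton⁻ l∈ , l′∈)

withCR-mono : ∀ P {R R′ s} → R′ S.⊆ R → s ∈ₚ withCR P R′ → s ∈ₚ withCR P R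
withCR-mono P {R} {R′} R′⊆R s∈ with ∈-++⁻ (reg P) s∈
... | inj₁ s∈reg = ∈-++⁺ˡ s∈reg
... | inj₂ s∈α with ∈-αSet⁻ {P} {R′} s∈α
...   | j , j∈ , refl = ∈-++⁺ʳ (reg P) (∈-αSet⁺ {P} {R} (R′⊆R j∈))

withCR-remove : ∀ P {R i s} → s ∈ₚ withCR P R → s ≢ α (crRule P i) →
                s ∈ₚ withCR P (R S.- i)
withCR-remove P {R} {i} s∈ s≢ with ∈-++⁻ (reg P) s∈
... | inj₁ s∈reg = ∈-++⁺ˡ s∈reg
... | inj₂ s∈α with ∈-αSet⁻ {P} {R} s∈α
...   | j , j∈ , refl =
  ∈-++⁺ʳ (reg P) (∈-αSet⁺ {P} {R S.- i} (SP.x∈p∧x≢y⇒x∈p-y j∈ λ { refl → s≢ refl }))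

-- By minimality of the abductive support R, α(rᵢ) is indispensable: X cannot
-- be supported by rules of P^reg ∪ α(R) other than α(rᵢ), for then X would
-- be an answer set of P^reg ∪ α(R − {i}) with |R − {i}| < |R|.
α-indispensable : ∀ P → Acyclic P → ∀ {X R} → AbductiveSupport P R →
                  AnswerSet (withCR P R) X → ∀ {i} → i ∈ₛ R →
                  ¬ (∀ x → x ∈ X →
                     ∃ λ s → s ∈ₚ withCR P R × s ≢ α (crRule P i) × Supports s x X)
α-indispensable P acyclic {X} {R} (_ , minimalR) A {i} i∈R avoiding =
  minimalR (R S.- i) (SP.x∈p⇒∣p-x∣<∣p∣ i∈R) (X , answerWithout)
  where
    answerWithout : AnswerSet (withCR P (R S.- i)) X
    answerWithout =
      supported⇒answerSet (Edge P) acyclic A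
        (withCR-mono P (SP.p─q⊆p R S.⁅ i ⁆)) (withCR-edge P (R S.- i))
        λ x x∈ → let (s , s∈ , s≢ , sup) = avoiding x x∈
                 in s , withCR-remove P s∈ s≢ , sup

lemma5 : (P : CRProgram) → Acyclic P →
         (X : Context) (R : CRSubset P) →
         AbductiveSupport P R → AnswerSet (withCR P R) X →
         (i : Fin (length (crs P))) → i ∈ₛ R →
         let r = crRule P i
             l = crHead r
         in Supports (α r) l X ×
            (∀ r′ → r′ ∈ₚ withCR P R → Supports r′ l X → r′ ≡ α r)
lemma5 P acyclic X R support A i i∈R = αSupports , onlyα
  where
    r = crRule P i
    l = crHead r

    indispensable : ¬ (∀ x → x ∈ X → ∃ λ s → s ∈ₚ withCR P R × s ≢ α r × Supports s x X)
    indispensable = α-indispensable P acyclic support A i∈R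

    -- α(r) fires (otherwise it supports nothing), so its only head l is in X.
    αSupports : Supports (α r) l X
    αSupports with fires? (α r) X
    ... | yes fires =
      fires , here refl , AnyP.singleton⁻ (All.lookup (answerSet⇒satisfies A) α∈ fires) ,
      λ l′ l′∈ _ → AnyP.singleton⁻ l′∈
      where
        α∈ : α r ∈ₚ withCR P R
        α∈ = ∈-++⁺ʳ (reg P) (∈-αSet⁺ {P} {R} i∈R)
    ... | no ¬fires = ⊥-elim (indispensable λ x x∈ →
      let (s , s∈ , sup) = answerSet⇒supported A x x∈
      in s , s∈ , (λ s≡ → ¬fires (subst (λ u → Fires u X) s≡ (proj₁ sup))) , sup)

    -- Another supporter r′ of l could take over the role of α(r).
    onlyα : ∀ r′ → r′ ∈ₚ withCR P R → Supports r′ l X → r′ ≡ α r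
    onlyα r′ r′∈ r′supports with r′ ≟R α r
    ... | yes r′≡ = r′≡
    ... | no r′≢ = ⊥-elim (indispensable replace)
      where
        replace : ∀ x → x ∈ X → ∃ λ s → s ∈ₚ withCR P R × s ≢ α r × Supports s x X
        replace x x∈ with answerSet⇒supported A x x∈
        ... | s , s∈ , sup with s ≟R α r
        ...   | no s≢ = s , s∈ , s≢ , sup
        ...   | yes refl =
          -- here s = α r, so the supported literal x is its head l
          r′ , r′∈ , r′≢ ,
          subst (λ y → Supports r′ y X) (sym (AnyP.singleton⁻ (proj₁ (proj₂ sup)))) r′supports
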